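{- Let $n\ge1$, let $w$ be a permutation of $[n]$, and let $m$ be a positive integer. Then $$\Omega(w,m)=2^{2\,\mathrm{pk}(w)+1}\sum_{k=0}^{m-1-\mathrm{pk}(w)}\left(\!\binom{n+1}{k}\!\right)\binom{n-2\,\mathrm{pk}(w)-1}{m-1-\mathrm{pk}(w)-k},$$ where $\left(\!\binom{n+1}{k}\!\right)=\binom{n+k}{k}$ denotes the number of multisets of cardinality $k$ on $[n+1]$ (an empty sum is $0$).
   Context: For a permutation $w=w_1\cdots w_n$, $\mathrm{Pk}(w)=\{i\in[2,n-1]:w_{i-1}<w_i>w_{i+1}\}$ and $\mathrm{pk}(w)=|\mathrm{Pk}(w)|$. Let $\mathbb{P}'$ be the nonzero integers ordered $-1\prec1\prec-2\prec2\prec\cdots$. An enriched $w$-partition is $f:[n]\to\mathbb{P}'$ with $f(w_1)\preceq\cdots\preceq f(w_n)$ such that for $i<j$, $f(w_i)=f(w_j)>0\Rightarrow w_i<w_j$ and $f(w_i)=f(w_j)<0\Rightarrow w_i>w_j$. $\Omega(w,m)$ is the number of enriched $w$-partitions $f$ with $|f(i)|\le m$ for all $i\in[n]$ (equivalently, the weight enumerator $\sum_f\prod_i x_{|f(i)|}$ evaluated at $x_1=\cdots=x_m=1$, $x_k=0$ for $k>m$). -}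

module Defs where

open import Data.Nat using (ℕ; zero; suc; _+_; _*_; _∸_; _≤_; _<_; _≤?_; _<?_)
import Data.Nat.Properties as ℕP
open import Data.Nat.Combinatorics using (_C_)
open import Data.Fin using (Fin; toℕ) renaming (_<_ to _<ᶠ_; _<?_ to _<ᶠ?_)
open import Data.Fin.Properties using (all?; any?)
open import Data.Fin.Permutation using (Permutation′; _⟨$⟩ʳ_)
open import Data.Vec using (Vec; []; _∷_; lookup)
open import Data.List using (List; []; _∷_; _++_; map; concatMap; length; filter; upTo; allFin)
open import Data.Nat.ListAction using (sum)
open import Data.Product using (Σ; _×_; _,_)
open import Data.Unit using (⊤; tt)
open import Data.Empty using (⊥)
open import Relation.Nullary using (Dec; yes; no; ¬_)
open import Relation.Nullary.Decidable using (_×-dec_; _→-dec_; map′)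
open import Relation.Binary.PropositionalEquality using (_≡_; refl; cong)

-- The set ℙ' of nonzero integers:  neg k  stands for  -(k+1),  pos k  for  k+1.
data P′ : Set where
  neg : ℕ → P′
  pos : ℕ → P′

∣_∣′ : P′ → ℕ
∣ neg k ∣′ = suc k
∣ pos k ∣′ = suc k

-- position in the total order  -1 ≺ 1 ≺ -2 ≺ 2 ≺ ⋯
rank : P′ → ℕ
rank (neg k) = 2 * k
rank (pos k) = suc (2 * k)

_⪯_ : P′ → P′ → Set
a ⪯ b = rank a ≤ rank b

IsPos : P′ → Set
IsPos (pos _) = ⊤
IsPos (neg _) = ⊥

IsNeg : P′ → Set
IsNeg (neg _) = ⊤
IsNeg (pos _) = ⊥

isPos? : (a : P′) → Dec (IsPos a)
isPos? (pos _) = yes tt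
isPos? (neg _) = no (λ ())

isNeg? : (a : P′) → Dec (IsNeg a)
isNeg? (neg _) = yes tt
isNeg? (pos _) = no (λ ())

_≟′_ : (a b : P′) → Dec (a ≡ b)
neg a ≟′ neg b with a ℕP.≟ b
... | yes refl = yes refl
... | no ne = no λ { refl → ne refl }
pos a ≟′ pos b with a ℕP.≟ b
... | yes refl = yes refl
... | no ne = no λ { refl → ne refl }
neg a ≟′ pos b = no (λ ())
pos a ≟′ neg b = no (λ ())

-- A permutation w of [n] (0-indexed): w_i = w ⟨$⟩ʳ i.
-- An enriched w-partition f : [n] → ℙ' (given as a vector, f(x) = lookup f x).
record IsEnriched {n : ℕ} (w : Permutation′ n) (f : Vec P′ n) : Set where
  field
    weak : ∀ (i j : Fin n) → i <ᶠ j →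
           lookup f (w ⟨$⟩ʳ i) ⪯ lookup f (w ⟨$⟩ʳ j)
    posCond : ∀ (i j : Fin n) → i <ᶠ j →
              lookup f (w ⟨$⟩ʳ i) ≡ lookup f (w ⟨$⟩ʳ j) →
              IsPos (lookup f (w ⟨$⟩ʳ i)) → (w ⟨$⟩ʳ i) <ᶠ (w ⟨$⟩ʳ j)
    negCond : ∀ (i j : Fin n) → i <ᶠ j →
              lookup f (w ⟨$⟩ʳ i) ≡ lookup f (w ⟨$⟩ʳ j) →
              IsNeg (lookup f (w ⟨$⟩ʳ i)) → (w ⟨$⟩ʳ j) <ᶠ (w ⟨$⟩ʳ i)

Bounded : {n : ℕ} → ℕ → Vec P′ n → Set
Bounded {n} m f = ∀ (x : Fin n) → ∣ lookup f x ∣′ ≤ m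

isEnriched? : {n : ℕ} (w : Permutation′ n) (f : Vec P′ n) → Dec (IsEnriched w f)
isEnriched? w f =
  map′ (λ { (a , b , c) → record { weak = a ; posCond = b ; negCond = c } })
       (λ e → IsEnriched.weak e , IsEnriched.posCond e , IsEnriched.negCond e)
       (all? (λ i → all? (λ j → (i <ᶠ? j) →-dec (rank (lookup f (w ⟨$⟩ʳ i)) ≤? rank (lookup f (w ⟨$⟩ʳ j)))))
        ×-dec
        all? (λ i → all? (λ j → (i <ᶠ? j) →-dec ((lookup f (w ⟨$⟩ʳ i) ≟′ lookup f (w ⟨$⟩ʳ j)) →-dec
              (isPos? (lookup f (w ⟨$⟩ʳ i)) →-dec ((w ⟨$⟩ʳ i) <ᶠ? (w ⟨$⟩ʳ j))))))
        ×-dec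
        all? (λ i → all? (λ j → (i <ᶠ? j) →-dec ((lookup f (w ⟨$⟩ʳ i) ≟′ lookup f (w ⟨$⟩ʳ j)) →-dec
              (isNeg? (lookup f (w ⟨$⟩ʳ i)) →-dec ((w ⟨$⟩ʳ j) <ᶠ? (w ⟨$⟩ʳ i)))))))

bounded? : {n : ℕ} (m : ℕ) (f : Vec P′ n) → Dec (Bounded m f)
bounded? m f = all? (λ x → ∣ lookup f x ∣′ ≤? m)

allVecs : {A : Set} (n : ℕ) → List A → List (Vec A n)
allVecs zero xs = [] ∷ []
allVecs (suc n) xs = concatMap (λ x → map (x ∷_) (allVecs n xs)) xs

candidates : ℕ → List P′
candidates m = map neg (upTo m) ++ map pos (upTo m)

Ω : {n : ℕ} → Permutation′ n → ℕ → ℕ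
Ω {n} w m = length (filter (λ f → isEnriched? w f ×-dec bounded? m f) (allVecs n (candidates m)))

IsPeak : {n : ℕ} → Permutation′ n → Fin n → Set
IsPeak {n} w i =
  Σ (Fin n) λ j → Σ (Fin n) λ k →
    (suc (toℕ j) ≡ toℕ i) × (toℕ k ≡ suc (toℕ i)) ×
    ((w ⟨$⟩ʳ j) <ᶠ (w ⟨$⟩ʳ i)) × ((w ⟨$⟩ʳ k) <ᶠ (w ⟨$⟩ʳ i))

isPeak? : {n : ℕ} (w : Permutation′ n) (i : Fin n) → Dec (IsPeak w i)
isPeak? w i =
  map′ (λ { (j , k , p) → j , k , p }) (λ { (j , k , p) → j , k , p })
    (any? λ j → any? λ k →
      (suc (toℕ j) ℕP.≟ toℕ i) ×-dec (toℕ k ℕP.≟ suc (toℕ i)) ×-dec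
      ((w ⟨$⟩ʳ j) <ᶠ? (w ⟨$⟩ʳ i)) ×-dec ((w ⟨$⟩ʳ k) <ᶠ? (w ⟨$⟩ʳ i)))

pk : {n : ℕ} → Permutation′ n → ℕ
pk {n} w = length (filter (isPeak? w) (allFin n))

multichoose : ℕ → ℕ → ℕ
multichoose n k = (n + k ∸ 1) C k

sumBelow : ℕ → (ℕ → ℕ) → ℕ
sumBelow N g = sum (map g (upTo N))

-- An enriched w-partition is a labelling of the letters by ℙ′
-- that is weakly increasing for ≺, where a label k > 0 may repeat only across an ascent and
-- a label −k only across a descent; this condition is transitive, so it suffices to impose
-- it on consecutive letters.  Counting the labellings of the first ℓ + 1 letters by their
-- last label ±(k + 1) gives a transfer recursion whose generating functions in x^k stay,
-- up to powers of 2, of the form xᴾ (1 + x)^q (1 − x)^−(ℓ+1) with P the number of peaks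
-- passed: every further letter multiplies the total by (1 + x)/(1 − x), except that a
-- letter completing a peak multiplies it by 4x/((1 + x)(1 − x)).  Summing over k < m
-- then extracts the coefficient of x^(m−1) in 2^(2pk+1) x^pk (1 + x)^(n−2pk−1) (1 − x)^−(n+1),
-- a convolution of multiset and binomial coefficients.

module Submission where

open import Defs
open import Data.Nat using (ℕ; zero; suc; _+_; _*_; _∸_; _^_; _≤_; _<_; z≤n; s≤s; _≤?_; _<?_)
open import Data.Nat.Properties
open import Data.Nat.Combinatorics using (_C_; nCk+nC[k+1]≡[n+1]C[k+1]; nCn≡1)
open import Data.Nat.Solver using (module +-*-Solver)
open import Data.Nat.ListAction using (sum)
open import Data.Nat.ListAction.Properties using (sum-++)
open import Data.Bool using (Bool; true; false; if_then_else_; _∧_; not)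
open import Data.Bool.Properties using (∧-identityʳ; ∧-zeroʳ)
open import Data.Product using (Σ; _×_; _,_; proj₁; proj₂)
open import Data.Sum using (inj₁; inj₂)
open import Data.Empty using (⊥-elim)
open import Data.Unit using (tt)
open import Data.Fin using (Fin; zero; suc; toℕ; fromℕ<; opposite) renaming (_<_ to _<ᶠ_)
open import Data.Fin.Properties using (toℕ<n; toℕ-injective; fromℕ<-toℕ; toℕ-fromℕ<; opposite-prop; opposite-involutive)
open import Data.Fin.Permutation using (Permutation′; _⟨$⟩ʳ_; _⟨$⟩ˡ_; inverseˡ; inverseʳ)
open import Data.List using (List; []; _∷_; map; _++_; concatMap; cartesianProductWith; length; filter; upTo; applyUpTo; allFin)
import Data.List as List
open import Data.List.Properties using (map-++; map-∘; map-cong)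
open import Data.List.Membership.Propositional using (_∈_)
open import Data.List.Membership.Propositional.Properties
  using (∈-map⁺; ∈-map⁻; ∈-++⁻; ∈-upTo⁻; ∈-cartesianProductWith⁺; ∈-cartesianProductWith⁻)
open import Data.List.Membership.Propositional.Properties.WithK using (unique∧set⇒bag)
open import Data.List.Relation.Binary.BagAndSetEquality using (∼bag⇒↭)
open import Data.List.Relation.Binary.Permutation.Propositional as ↭ using (_↭_)
open import Data.List.Relation.Unary.Any using (here; there)
import Data.List.Relation.Unary.All as All
open import Data.List.Relation.Unary.AllPairs using ([]; _∷_)
open import Data.List.Relation.Unary.Unique.Propositional using (Unique)
import Data.List.Relation.Unary.Unique.Propositional.Properties as Unique
open import Data.Vec using (Vec; []; _∷_; lookup; tabulate)
open import Data.Vec.Properties using (∷-injective; lookup∘tabulate; tabulate∘lookup; tabulate-cong)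
open import Function using (_∘_)
open import Function.Bundles using (mk⇔)
open import Relation.Binary using (tri<; tri≈; tri>)
open import Relation.Nullary using (Dec; yes; no; does; ¬_)
open import Relation.Nullary.Decidable using (dec-true; dec-false; does-⇔; decidable-stable; _×-dec_; _→-dec_)
open import Relation.Binary.PropositionalEquality

open +-*-Solver

sum< : ℕ → (ℕ → ℕ) → ℕ
sum< zero    f = 0
sum< (suc N) f = sum< N f + f N

sum<-cong : ∀ N {f g : ℕ → ℕ} → (∀ k → k < N → f k ≡ g k) → sum< N f ≡ sum< N g
sum<-cong zero    f≡g = refl
sum<-cong (suc N) f≡g = cong₂ _+_ (sum<-cong N (λ k k<N → f≡g k (m<n⇒m<1+n k<N))) (f≡g N (n<1+n N))

sum<-distrib-+ : ∀ N (f g : ℕ → ℕ) → sum< N (λ k → f k + g k) ≡ sum< N f + sum< N g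
sum<-distrib-+ zero    f g = refl
sum<-distrib-+ (suc N) f g rewrite sum<-distrib-+ N f g =
  solve 4 (λ a b c d → (a :+ b) :+ (c :+ d) := (a :+ c) :+ (b :+ d)) refl (sum< N f) (sum< N g) (f N) (g N)

sum<-distribˡ-* : ∀ N c (f : ℕ → ℕ) → sum< N (λ k → c * f k) ≡ c * sum< N f
sum<-distribˡ-* zero    c f = sym (*-zeroʳ c)
sum<-distribˡ-* (suc N) c f rewrite sum<-distribˡ-* N c f = sym (*-distribˡ-+ c (sum< N f) (f N))

sum<-zero : ∀ N (f : ℕ → ℕ) → (∀ k → k < N → f k ≡ 0) → sum< N f ≡ 0
sum<-zero zero    f f≡0 = refl
sum<-zero (suc N) f f≡0
  rewrite sum<-zero N f (λ k k<N → f≡0 k (m<n⇒m<1+n k<N)) | f≡0 N (n<1+n N) = refl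

sum<-suc-head : ∀ N (f : ℕ → ℕ) → sum< (suc N) f ≡ f 0 + sum< N (λ k → f (suc k))
sum<-suc-head zero    f = +-comm 0 (f 0)
sum<-suc-head (suc N) f rewrite sum<-suc-head N f = +-assoc (f 0) (sum< N (λ k → f (suc k))) (f (suc N))

sum-applyUpTo : ∀ N (f g : ℕ → ℕ) → sum (map f (applyUpTo g N)) ≡ sum< N (λ k → f (g k))
sum-applyUpTo zero    f g = refl
sum-applyUpTo (suc N) f g rewrite sum-applyUpTo N f (λ k → g (suc k)) = sym (sum<-suc-head N (λ k → f (g k)))

sumBelow≡sum< : ∀ N f → sumBelow N f ≡ sum< N f
sumBelow≡sum< N f = sum-applyUpTo N f (λ k → k)

sum<-indicator : ∀ k M (holds : ℕ → Bool) (g : ℕ → ℕ) → k < M →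
  (∀ k′ → k′ < k → holds k′ ≡ true) → (∀ k′ → k < k′ → holds k′ ≡ false) →
  sum< M (λ k′ → if holds k′ then g k′ else 0) ≡ sum< k g + (if holds k then g k else 0)
sum<-indicator k (suc M) holds g (s≤s k≤M) below above with m≤n⇒m<n∨m≡n k≤M
... | inj₂ refl = cong (_+ (if holds k then g k else 0))
                       (sum<-cong k (λ k′ k′<k → cong (if_then g k′ else 0) (below k′ k′<k)))
... | inj₁ k<M rewrite above M k<M = trans (+-identityʳ _) (sum<-indicator k M holds g k<M below above)

-- Generating functions

shift : (ℕ → ℕ) → ℕ → ℕ
shift f zero    = 0
shift f (suc k) = f k

-- coeff p b c k is the coefficient of xᵏ in xᵖ (1 + x)ᵇ (1 − x)⁻ᶜ.
coeff : ℕ → ℕ → ℕ → ℕ → ℕ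
coeff zero    zero    c k = multichoose c k
coeff zero    (suc b) c k = coeff zero b c k + shift (coeff zero b c) k
coeff (suc p) b       c k = shift (coeff p b c) k

multichoose-pascal : ∀ c k → multichoose (suc c) (suc k) ≡ multichoose c (suc k) + multichoose (suc c) k
multichoose-pascal c k rewrite +-suc c k = sym (trans (+-comm ((c + k) C suc k) _) (nCk+nC[k+1]≡[n+1]C[k+1] (c + k) k))

coeff-suc-b : ∀ p b c k → coeff p (suc b) c k ≡ coeff p b c k + coeff (suc p) b c k
coeff-suc-b zero    b c k       = refl
coeff-suc-b (suc p) b c zero    = refl
coeff-suc-b (suc p) b c (suc k) = coeff-suc-b p b c k

-- (1 − x) · (1 − x)⁻⁽ᶜ⁺¹⁾ = (1 − x)⁻ᶜ, read off coefficientwise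
coeff-suc-c : ∀ p b c k → coeff p b (suc c) k ≡ coeff p b c k + coeff (suc p) b (suc c) k
coeff-suc-c zero    zero    c zero    = refl
coeff-suc-c zero    zero    c (suc k) = multichoose-pascal c k
coeff-suc-c zero    (suc b) c zero    rewrite coeff-suc-c zero b c zero = refl
coeff-suc-c zero    (suc b) c (suc k) rewrite coeff-suc-c zero b c (suc k) | coeff-suc-c zero b c k =
  solve 3 (λ a d s → (a :+ (d :+ s)) :+ (d :+ s) := (a :+ d) :+ ((d :+ s) :+ s)) refl
    (coeff zero b c (suc k)) (coeff zero b c k) (shift (coeff zero b (suc c)) k)
coeff-suc-c (suc p) b c zero    = refl
coeff-suc-c (suc p) b c (suc k) = coeff-suc-c p b c k

sum<-coeff : ∀ p b c k → sum< k (coeff p b c) ≡ coeff (suc p) b (suc c) k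
sum<-coeff p b c zero    = refl
sum<-coeff p b c (suc k) rewrite sum<-coeff p b c k | coeff-suc-c p b c k = +-comm _ (coeff p b c k)

coeff-below : ∀ p b c k → k < p → coeff p b c k ≡ 0
coeff-below (suc p) b c zero    _           = refl
coeff-below (suc p) b c (suc k) (s≤s k<p) = coeff-below p b c k k<p

coeff-+ : ∀ p b c j → coeff p b c (p + j) ≡ coeff zero b c j
coeff-+ zero    b c j = refl
coeff-+ (suc p) b c j = coeff-+ p b c j

coeff-convolution : ∀ b c j → coeff zero b c j ≡ sum< (suc j) (λ i → multichoose c i * (b C (j ∸ i)))
coeff-convolution zero c j = sym (begin
  sum< j (λ i → multichoose c i * (0 C (j ∸ i))) + multichoose c j * (0 C (j ∸ j))
    ≡⟨ cong₂ _+_ (sum<-zero j _ vanish) (cong (λ d → multichoose c j * (0 C d)) (n∸n≡0 j)) ⟩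
  multichoose c j * 1
    ≡⟨ *-identityʳ _ ⟩
  multichoose c j ∎)
  where
  open ≡-Reasoning
  vanish : ∀ i → i < j → multichoose c i * (0 C (j ∸ i)) ≡ 0
  vanish i (s≤s i≤j′) rewrite +-∸-assoc 1 i≤j′ = *-zeroʳ (multichoose c i)
coeff-convolution (suc b) c zero rewrite coeff-convolution b c zero = +-identityʳ _
coeff-convolution (suc b) c (suc j) = begin
  coeff zero b c (suc j) + coeff zero b c j
    ≡⟨ cong₂ _+_ (coeff-convolution b c (suc j)) (coeff-convolution b c j) ⟩
  (S₁ + multichoose c (suc j) * (b C (j ∸ j))) + S₀
    ≡⟨ +-comm-middle S₁ _ S₀ ⟩
  (S₁ + S₀) + multichoose c (suc j) * (b C (j ∸ j))
    ≡⟨ cong₂ _+_ (trans (sym (sum<-distrib-+ (suc j) _ _)) (sum<-cong (suc j) pascal)) lastTerm ⟩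
  sum< (suc j) (λ i → multichoose c i * (suc b C (suc j ∸ i))) + multichoose c (suc j) * (suc b C (j ∸ j)) ∎
  where
  open ≡-Reasoning
  S₁ = sum< (suc j) (λ i → multichoose c i * (b C (suc j ∸ i)))
  S₀ = sum< (suc j) (λ i → multichoose c i * (b C (j ∸ i)))
  +-comm-middle : ∀ x y z → (x + y) + z ≡ (x + z) + y
  +-comm-middle = solve 3 (λ x y z → (x :+ y) :+ z := (x :+ z) :+ y) refl
  lastTerm : multichoose c (suc j) * (b C (j ∸ j)) ≡ multichoose c (suc j) * (suc b C (j ∸ j))
  lastTerm rewrite n∸n≡0 j = refl
  pascal : ∀ i → i < suc j →
    multichoose c i * (b C (suc j ∸ i)) + multichoose c i * (b C (j ∸ i)) ≡ multichoose c i * (suc b C (suc j ∸ i))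
  pascal i (s≤s i≤j) rewrite +-∸-assoc 1 i≤j =
    trans (sym (*-distribˡ-+ (multichoose c i) _ _))
          (cong (multichoose c i *_) (trans (+-comm (b C suc (j ∸ i)) (b C (j ∸ i))) (nCk+nC[k+1]≡[n+1]C[k+1] b (j ∸ i))))

coeff≡sumBelow : ∀ P q c m →
  coeff (suc P) q c m ≡ sumBelow (m ∸ P) (λ k → multichoose c k * (q C (m ∸ 1 ∸ P ∸ k)))
coeff≡sumBelow P q c m with m ≤? P
... | yes m≤P rewrite m≤n⇒m∸n≡0 m≤P = coeff-below (suc P) q c m (s≤s m≤P)
... | no m≰P with j , refl ← m≤n⇒∃[o]m+o≡n (≰⇒> m≰P) = begin
  coeff (suc P) q c (suc P + j)
    ≡⟨ coeff-+ (suc P) q c j ⟩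
  coeff zero q c j
    ≡⟨ coeff-convolution q c j ⟩
  sum< (suc j) (λ k → multichoose c k * (q C (j ∸ k)))
    ≡⟨ sumBelow≡sum< (suc j) _ ⟨
  sumBelow (suc j) (λ k → multichoose c k * (q C (j ∸ k)))
    ≡⟨ cong₂ sumBelow (sym (trans (cong (_∸ P) (sym (+-suc P j))) (m+n∸m≡n P (suc j))))
                      (cong (λ j′ k → multichoose c k * (q C (j′ ∸ k))) (sym (m+n∸m≡n P j))) ⟩
  sumBelow (suc P + j ∸ P) (λ k → multichoose c k * (q C (suc P + j ∸ 1 ∸ P ∸ k))) ∎
  where open ≡-Reasoning

-- The transfer recursion

sum<-scaled-coeff : ∀ k (f : ℕ → ℕ) d p b c → (∀ i → f i ≡ d * coeff p b c i) →
  sum< k f ≡ d * coeff (suc p) b (suc c) k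
sum<-scaled-coeff k f d p b c f≡ =
  trans (sum<-cong k (λ i _ → f≡ i)) (trans (sum<-distribˡ-* k d (coeff p b c)) (cong (d *_) (sum<-coeff p b c k)))

2^[2P+1]≡2*4^P : ∀ P → 2 ^ (2 * P + 1) ≡ 2 * 4 ^ P
2^[2P+1]≡2*4^P zero    = refl
2^[2P+1]≡2*4^P (suc P) rewrite +-suc P (P + 0) | 2^[2P+1]≡2*4^P P =
  solve 1 (λ c → con 2 :* (con 2 :* (con 2 :* c)) := con 2 :* (con 4 :* c)) refl (4 ^ P)

subtract-twice : ∀ {N q a b} → N ≡ q + a + b → N ∸ a ∸ b ≡ q
subtract-twice {q = q} {a} {b} refl =
  trans (∸-+-assoc (q + a + b) a b) (trans (cong (_∸ (a + b)) (+-assoc q a b)) (m+n∸n≡m q (a + b)))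

module Transfer (ascent : ℕ → Bool) where

  -- With letter ℓ of the word followed by letter ℓ + 1 according to ascent ℓ,
  -- endPos ℓ k (endNeg ℓ k) counts the enriched labelings of letters 0 … ℓ whose label
  -- on letter ℓ is k + 1 (resp. −(k + 1)).
  mutual
    endPos : ℕ → ℕ → ℕ
    endPos zero    k = 1
    endPos (suc ℓ) k = prefix ℓ k + endNeg ℓ k + (if ascent ℓ then endPos ℓ k else 0)

    endNeg : ℕ → ℕ → ℕ
    endNeg zero    k = 1
    endNeg (suc ℓ) k = prefix ℓ k + (if ascent ℓ then 0 else endNeg ℓ k)

    prefix : ℕ → ℕ → ℕ
    prefix ℓ k = sum< k (λ i → endPos ℓ i + endNeg ℓ i)

  prefix-split : ∀ ℓ k → prefix ℓ k ≡ sum< k (endPos ℓ) + sum< k (endNeg ℓ)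
  prefix-split ℓ k = sum<-distrib-+ k (endPos ℓ) (endNeg ℓ)

  ascentInto : ℕ → Bool
  ascentInto zero    = false
  ascentInto (suc ℓ) = ascent ℓ

  isPeakᵇ : ℕ → Bool
  isPeakᵇ ℓ = ascentInto ℓ ∧ not (ascent ℓ)

  peaksBelow : ℕ → ℕ
  peaksBelow ℓ = sum< ℓ (λ t → if isPeakᵇ t then 1 else 0)

  -- Closed forms at letter ℓ with P peaks before it: up to a power of 2 the generating
  -- functions of endPos ℓ and endNeg ℓ are xᴾ (1 + x)^q (1 − x)^−(ℓ+1) and, right after an
  -- ascent, x times it.
  ClosedForm : Bool → ℕ → ℕ → ℕ → Set
  ClosedForm false ℓ P q = (suc ℓ ≡ q + 2 * P + 1) ×
    (∀ k → endPos ℓ k ≡ 4 ^ P * coeff P q (suc ℓ) k) ×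
    (∀ k → endNeg ℓ k ≡ 4 ^ P * coeff P q (suc ℓ) k)
  ClosedForm true ℓ P q = (suc ℓ ≡ q + 2 * P + 2) ×
    (∀ k → endPos ℓ k ≡ 2 * 4 ^ P * coeff P q (suc ℓ) k) ×
    (∀ k → endNeg ℓ k ≡ 2 * 4 ^ P * coeff (suc P) q (suc ℓ) k)

  TotalClosedForm : ℕ → ℕ → ℕ → Set
  TotalClosedForm ℓ P q = ∀ k → endPos ℓ k + endNeg ℓ k ≡ 2 * 4 ^ P * coeff P q (suc ℓ) k

  total-after-descent : ∀ ℓ P q → ClosedForm false ℓ P q → TotalClosedForm ℓ P q
  total-after-descent ℓ P q (_ , pos≡ , neg≡) k =
    trans (cong₂ _+_ (pos≡ k) (neg≡ k)) (solve 2 (λ c g → c :* g :+ c :* g := (con 2 :* c) :* g) refl (4 ^ P) _)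

  total-after-ascent : ∀ ℓ P q → ClosedForm true ℓ P q → TotalClosedForm ℓ P (suc q)
  total-after-ascent ℓ P q (_ , pos≡ , neg≡) k =
    trans (cong₂ _+_ (pos≡ k) (neg≡ k))
      (trans (sym (*-distribˡ-+ (2 * 4 ^ P) _ _)) (cong (2 * 4 ^ P *_) (sym (coeff-suc-b P q (suc ℓ) k))))

  prefix≡ : ∀ ℓ P q → TotalClosedForm ℓ P q → ∀ k → prefix ℓ k ≡ 2 * 4 ^ P * coeff (suc P) q (suc (suc ℓ)) k
  prefix≡ ℓ P q tot k = sum<-scaled-coeff k _ (2 * 4 ^ P) P q (suc ℓ) tot

  descent-ascent : ∀ ℓ P q → ClosedForm false ℓ P q → ascent ℓ ≡ true → ClosedForm true (suc ℓ) P q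
  descent-ascent ℓ P q s@(len , pos≡ , neg≡) up = trans (cong suc len) (sym (+-suc (q + 2 * P) 1)) , pos′ , neg′
    where
    c = 4 ^ P
    pre = prefix≡ ℓ P q (total-after-descent ℓ P q s)
    pos′ : ∀ k → endPos (suc ℓ) k ≡ 2 * c * coeff P q (suc (suc ℓ)) k
    pos′ k rewrite up | pre k | pos≡ k | neg≡ k | coeff-suc-c P q (suc ℓ) k =
      solve 3 (λ c s g → (con 2 :* c) :* s :+ c :* g :+ c :* g := (con 2 :* c) :* (g :+ s)) refl
        c (coeff (suc P) q (suc (suc ℓ)) k) (coeff P q (suc ℓ) k)
    neg′ : ∀ k → endNeg (suc ℓ) k ≡ 2 * c * coeff (suc P) q (suc (suc ℓ)) k
    neg′ k rewrite up | pre k = +-identityʳ _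

  descent-descent : ∀ ℓ P q → ClosedForm false ℓ P q → ascent ℓ ≡ false → ClosedForm false (suc ℓ) P (suc q)
  descent-descent ℓ P q s@(len , pos≡ , neg≡) down = cong suc len , pos′ , neg′
    where
    c = 4 ^ P
    pre = prefix≡ ℓ P q (total-after-descent ℓ P q s)
    key : ∀ k → prefix ℓ k + endNeg ℓ k ≡ c * coeff P (suc q) (suc (suc ℓ)) k
    key k rewrite pre k | neg≡ k | coeff-suc-b P q (suc (suc ℓ)) k | coeff-suc-c P q (suc ℓ) k =
      solve 3 (λ c s g → (con 2 :* c) :* s :+ c :* g := c :* ((g :+ s) :+ s)) refl
        c (coeff (suc P) q (suc (suc ℓ)) k) (coeff P q (suc ℓ) k)
    pos′ : ∀ k → endPos (suc ℓ) k ≡ c * coeff P (suc q) (suc (suc ℓ)) k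
    pos′ k rewrite down = trans (+-identityʳ _) (key k)
    neg′ : ∀ k → endNeg (suc ℓ) k ≡ c * coeff P (suc q) (suc (suc ℓ)) k
    neg′ k rewrite down = key k

  ascent-ascent : ∀ ℓ P q → ClosedForm true ℓ P q → ascent ℓ ≡ true → ClosedForm true (suc ℓ) P (suc q)
  ascent-ascent ℓ P q s@(len , pos≡ , neg≡) up = cong suc len , pos′ , neg′
    where
    d = 2 * 4 ^ P
    pre = prefix≡ ℓ P (suc q) (total-after-ascent ℓ P q s)
    pos′ : ∀ k → endPos (suc ℓ) k ≡ d * coeff P (suc q) (suc (suc ℓ)) k
    pos′ k rewrite up | pre k | pos≡ k | neg≡ k | coeff-suc-c P (suc q) (suc ℓ) k | coeff-suc-b P q (suc ℓ) k =
      solve 4 (λ d s x y → d :* s :+ d :* y :+ d :* x := d :* ((x :+ y) :+ s)) refl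
        d (coeff (suc P) (suc q) (suc (suc ℓ)) k) (coeff P q (suc ℓ) k) (coeff (suc P) q (suc ℓ) k)
    neg′ : ∀ k → endNeg (suc ℓ) k ≡ d * coeff (suc P) (suc q) (suc (suc ℓ)) k
    neg′ k rewrite up | pre k = +-identityʳ _

  ascent-descent : ∀ ℓ P q → ClosedForm true ℓ P q → ascent ℓ ≡ false → ClosedForm false (suc ℓ) (suc P) q
  ascent-descent ℓ P q s@(len , pos≡ , neg≡) down = len′ , pos′ , neg′
    where
    c = 4 ^ P
    len′ : suc (suc ℓ) ≡ q + 2 * suc P + 1
    len′ = trans (cong suc len)
      (solve 2 (λ q p → con 1 :+ (q :+ con 2 :* p :+ con 2) := q :+ con 2 :* (con 1 :+ p) :+ con 1) refl q P)
    pre = prefix≡ ℓ P (suc q) (total-after-ascent ℓ P q s)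
    key : ∀ k → prefix ℓ k + endNeg ℓ k ≡ 4 ^ suc P * coeff (suc P) q (suc (suc ℓ)) k
    key k rewrite pre k | neg≡ k | coeff-suc-b (suc P) q (suc (suc ℓ)) k | coeff-suc-c (suc P) q (suc ℓ) k =
      solve 3 (λ c y s → (con 2 :* c) :* ((y :+ s) :+ s) :+ (con 2 :* c) :* y := (con 4 :* c) :* (y :+ s)) refl
        c (coeff (suc P) q (suc ℓ) k) (coeff (suc (suc P)) q (suc (suc ℓ)) k)
    pos′ : ∀ k → endPos (suc ℓ) k ≡ 4 ^ suc P * coeff (suc P) q (suc (suc ℓ)) k
    pos′ k rewrite down = trans (+-identityʳ _) (key k)
    neg′ : ∀ k → endNeg (suc ℓ) k ≡ 4 ^ suc P * coeff (suc P) q (suc (suc ℓ)) k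
    neg′ k rewrite down = key k

  closedForm-step : ∀ t u ℓ P q → ClosedForm t ℓ P q → ascent ℓ ≡ u →
    Σ ℕ (ClosedForm u (suc ℓ) (P + (if t ∧ not u then 1 else 0)))
  closedForm-step false true  ℓ P q s up   =
    q , subst (λ P′ → ClosedForm true (suc ℓ) P′ q) (sym (+-identityʳ P)) (descent-ascent ℓ P q s up)
  closedForm-step false false ℓ P q s down =
    suc q , subst (λ P′ → ClosedForm false (suc ℓ) P′ (suc q)) (sym (+-identityʳ P)) (descent-descent ℓ P q s down)
  closedForm-step true  true  ℓ P q s up   =
    suc q , subst (λ P′ → ClosedForm true (suc ℓ) P′ (suc q)) (sym (+-identityʳ P)) (ascent-ascent ℓ P q s up)
  closedForm-step true  false ℓ P q s down =
    q , subst (λ P′ → ClosedForm false (suc ℓ) P′ q) (+-comm 1 P) (ascent-descent ℓ P q s down)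

  closedForm : ∀ ℓ → Σ ℕ (ClosedForm (ascentInto ℓ) ℓ (peaksBelow ℓ))
  closedForm zero = 0 , refl , one , one
    where
    one : ∀ k → 1 ≡ 1 * coeff 0 0 1 k
    one k = sym (trans (*-identityˡ _) (nCn≡1 k))
  closedForm (suc ℓ) with closedForm ℓ
  ... | q , s = closedForm-step (ascentInto ℓ) (ascent ℓ) ℓ (peaksBelow ℓ) q s refl

  totalClosedForm : ∀ ℓ → Σ ℕ λ q → (suc ℓ ≡ q + 2 * peaksBelow ℓ + 1) × TotalClosedForm ℓ (peaksBelow ℓ) q
  totalClosedForm ℓ with ascentInto ℓ | closedForm ℓ
  ... | false | q , s = q , proj₁ s , total-after-descent ℓ (peaksBelow ℓ) q s
  ... | true  | q , s = suc q , trans (proj₁ s) (+-suc (q + 2 * peaksBelow ℓ) 1) , total-after-ascent ℓ (peaksBelow ℓ) q s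

  prefix-closed-form : ∀ ℓ m → prefix ℓ m ≡
    2 ^ (2 * peaksBelow ℓ + 1) * coeff (suc (peaksBelow ℓ)) (suc ℓ ∸ 2 * peaksBelow ℓ ∸ 1) (suc (suc ℓ)) m
  prefix-closed-form ℓ m with totalClosedForm ℓ
  ... | q , len , tot = trans (prefix≡ ℓ P q tot m)
    (sym (cong₂ (λ d b → d * coeff (suc P) b (suc (suc ℓ)) m) (2^[2P+1]≡2*4^P P) (subtract-twice len)))
    where P = peaksBelow ℓ

-- Admissible pairs of consecutive labels

∧-true : ∀ {a b} → a ∧ b ≡ true → a ≡ true × b ≡ true
∧-true {true} {true} _ = refl , refl

does-true : ∀ {P : Set} (P? : Dec P) → does P? ≡ true → P
does-true (yes p) _ = p

does≡ : ∀ {P : Set} (P? : Dec P) (b : Bool) → (P → b ≡ true) → (b ≡ true → P) → does P? ≡ b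
does≡ (yes p) b to _    = sym (to p)
does≡ (no ¬p) true _ from = ⊥-elim (¬p (from refl))
does≡ (no ¬p) false _ _   = refl

does-false : ∀ {P : Set} (P? : Dec P) → does P? ≡ false → ¬ P
does-false (no ¬p) _ = ¬p

not-true : ∀ {b} → not b ≡ true → b ≡ false
not-true {false} _ = refl

odd<even : ∀ {i j} → i < j → suc (2 * i) < 2 * j
odd<even {i} {j} i<j = subst (_≤ 2 * j) (*-suc 2 i) (*-monoʳ-≤ 2 i<j)

∣∣<⇒rank< : ∀ x y → ∣ x ∣′ < ∣ y ∣′ → rank x < rank y
∣∣<⇒rank< (neg i) (neg j) (s≤s i<j) = <-trans (n<1+n (2 * i)) (odd<even i<j)
∣∣<⇒rank< (neg i) (pos j) (s≤s i<j) = <-trans (n<1+n (2 * i)) (m<n⇒m<1+n (odd<even i<j))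
∣∣<⇒rank< (pos i) (neg j) (s≤s i<j) = odd<even i<j
∣∣<⇒rank< (pos i) (pos j) (s≤s i<j) = m<n⇒m<1+n (odd<even i<j)

rank-injective : ∀ x y → rank x ≡ rank y → x ≡ y
rank-injective x y eq with <-cmp ∣ x ∣′ ∣ y ∣′
... | tri< lt _ _ = ⊥-elim (<-irrefl eq (∣∣<⇒rank< x y lt))
... | tri> _ _ gt = ⊥-elim (<-irrefl (sym eq) (∣∣<⇒rank< y x gt))
... | tri≈ _ same _ = equal-size x y same eq
  where
  equal-size : ∀ x y → ∣ x ∣′ ≡ ∣ y ∣′ → rank x ≡ rank y → x ≡ y
  equal-size (neg i) (neg j) refl _  = refl
  equal-size (pos i) (pos j) refl _  = refl
  equal-size (neg i) (pos j) refl eq = ⊥-elim (1+n≢n (sym eq))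
  equal-size (pos i) (neg j) refl eq = ⊥-elim (1+n≢n eq)

-- Label x on a letter of value a may be followed by label y on a letter of value b.
Admissible : P′ → ℕ → P′ → ℕ → Set
Admissible x a y b = x ⪯ y × (x ≡ y → IsPos x → a < b) × (x ≡ y → IsNeg x → b < a)

admissible? : ∀ x a y b → Dec (Admissible x a y b)
admissible? x a y b = (rank x ≤? rank y)
  ×-dec ((x ≟′ y) →-dec (isPos? x →-dec (a <? b)))
  ×-dec ((x ≟′ y) →-dec (isNeg? x →-dec (b <? a)))

admissibleᵇ : P′ → ℕ → P′ → ℕ → Bool
admissibleᵇ x a y b = does (admissible? x a y b)

admissible-trans : ∀ {x a y b z c} → Admissible x a y b → Admissible y b z c → Admissible x a z c
admissible-trans {x} {a} {y} {b} {z} {c} (x⪯y , posˣʸ , negˣʸ) (y⪯z , posʸᶻ , negʸᶻ) =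
  ≤-trans x⪯y y⪯z , posˣᶻ , negˣᶻ
  where
  middle : x ≡ z → x ≡ y
  middle refl = rank-injective x y (≤-antisym x⪯y y⪯z)
  posˣᶻ : x ≡ z → IsPos x → a < c
  posˣᶻ x≡z p with middle x≡z
  ... | refl = <-trans (posˣʸ refl p) (posʸᶻ x≡z p)
  negˣᶻ : x ≡ z → IsNeg x → c < a
  negˣᶻ x≡z n with middle x≡z
  ... | refl = <-trans (negʸᶻ x≡z n) (negˣʸ refl n)

Admissible-cong : ∀ {x x′ a a′ y y′ b b′} → x ≡ x′ → a ≡ a′ → y ≡ y′ → b ≡ b′ →
  Admissible x a y b → Admissible x′ a′ y′ b′
Admissible-cong refl refl refl refl adm = adm

admissibleᵇ-rank< : ∀ x a y b → rank x < rank y → admissibleᵇ x a y b ≡ true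
admissibleᵇ-rank< x a y b lt = dec-true (admissible? x a y b)
  (<⇒≤ lt , (λ { refl → ⊥-elim (<-irrefl refl lt) }) , (λ { refl → ⊥-elim (<-irrefl refl lt) }))

admissibleᵇ-rank> : ∀ x a y b → rank y < rank x → admissibleᵇ x a y b ≡ false
admissibleᵇ-rank> x a y b gt = dec-false (admissible? x a y b) (λ adm → <⇒≱ gt (proj₁ adm))

admissibleᵇ-pos : ∀ k a b → admissibleᵇ (pos k) a (pos k) b ≡ does (a <? b)
admissibleᵇ-pos k a b =
  does-⇔ (mk⇔ (λ adm → proj₁ (proj₂ adm) refl tt) (λ a<b → ≤-refl , (λ _ _ → a<b) , (λ _ ())))
         (admissible? (pos k) a (pos k) b) (a <? b)

admissibleᵇ-neg : ∀ k a b → admissibleᵇ (neg k) a (neg k) b ≡ does (b <? a)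
admissibleᵇ-neg k a b =
  does-⇔ (mk⇔ (λ adm → proj₂ (proj₂ adm) refl tt) (λ b<a → ≤-refl , (λ _ ()) , (λ _ _ → b<a)))
         (admissible? (neg k) a (neg k) b) (b <? a)

sum<-admissible : ∀ (label : ℕ → P′) → (∀ i → ∣ label i ∣′ ≡ suc i) →
  ∀ y k → ∣ y ∣′ ≡ suc k → ∀ M → k < M → ∀ a b (f : ℕ → ℕ) →
  sum< M (λ i → if admissibleᵇ (label i) a y b then f i else 0) ≡ sum< k f + (if admissibleᵇ (label k) a y b then f k else 0)
sum<-admissible label ∣label∣ y k ∣y∣ M k<M a b f =
  sum<-indicator k M (λ i → admissibleᵇ (label i) a y b) f k<M below above
  where
  below : ∀ i → i < k → admissibleᵇ (label i) a y b ≡ true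
  below i i<k = admissibleᵇ-rank< (label i) a y b
    (∣∣<⇒rank< (label i) y (subst₂ _<_ (sym (∣label∣ i)) (sym ∣y∣) (s≤s i<k)))
  above : ∀ i → k < i → admissibleᵇ (label i) a y b ≡ false
  above i k<i = admissibleᵇ-rank> (label i) a y b
    (∣∣<⇒rank< y (label i) (subst₂ _<_ (sym ∣y∣) (sym (∣label∣ i)) (s≤s k<i)))

does-flip-< : ∀ a b → a ≢ b → does (b <? a) ≡ not (does (a <? b))
does-flip-< a b a≢b with <-cmp a b
... | tri< a<b _ _ rewrite dec-true (a <? b) a<b | dec-false (b <? a) (<-asym a<b) = refl
... | tri≈ _ a≡b _ = ⊥-elim (a≢b a≡b)
... | tri> a≮b _ b<a rewrite dec-false (a <? b) a≮b | dec-true (b <? a) b<a = refl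

count : {A : Set} → (A → Bool) → List A → ℕ
count p []       = 0
count p (x ∷ xs) = (if p x then 1 else 0) + count p xs

length-filter≡count : {A : Set} {P : A → Set} (P? : ∀ x → Dec (P x)) (xs : List A) →
  length (filter P? xs) ≡ count (λ x → does (P? x)) xs
length-filter≡count P? []       = refl
length-filter≡count P? (x ∷ xs) with does (P? x)
... | true  = cong suc (length-filter≡count P? xs)
... | false = length-filter≡count P? xs

count-++ : {A : Set} (p : A → Bool) (xs ys : List A) → count p (xs ++ ys) ≡ count p xs + count p ys
count-++ p []       ys = refl
count-++ p (x ∷ xs) ys rewrite count-++ p xs ys = sym (+-assoc (if p x then 1 else 0) (count p xs) (count p ys))

count-map : {A B : Set} (p : B → Bool) (f : A → B) (xs : List A) → count p (map f xs) ≡ count (λ x → p (f x)) xs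
count-map p f []       = refl
count-map p f (x ∷ xs) rewrite count-map p f xs = refl

count-concatMap : {A B : Set} (p : B → Bool) (f : A → List B) (xs : List A) →
  count p (concatMap f xs) ≡ sum (map (λ x → count p (f x)) xs)
count-concatMap p f []       = refl
count-concatMap p f (x ∷ xs) rewrite count-++ p (f x) (concatMap f xs) | count-concatMap p f xs = refl

count-∧ : {A : Set} (b : Bool) (p : A → Bool) (xs : List A) → count (λ x → b ∧ p x) xs ≡ (if b then count p xs else 0)
count-∧ true  p xs       = refl
count-∧ false p []       = refl
count-∧ false p (x ∷ xs) = count-∧ false p xs

sum-map-candidates : ∀ m (h : P′ → ℕ) →
  sum (map h (candidates m)) ≡ sum< m (λ k → h (neg k)) + sum< m (λ k → h (pos k))
sum-map-candidates m h
  rewrite map-++ h (map neg (upTo m)) (map pos (upTo m)) | sum-++ (map h (map neg (upTo m))) (map h (map pos (upTo m)))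
        | sym (map-∘ {g = h} {f = neg} (upTo m)) | sym (map-∘ {g = h} {f = pos} (upTo m)) =
  cong₂ _+_ (sumBelow≡sum< m (λ k → h (neg k))) (sumBelow≡sum< m (λ k → h (pos k)))

candidates-bounded : ∀ m {y} → y ∈ candidates m → ∣ y ∣′ ≤ m
candidates-bounded m y∈ with ∈-++⁻ (map neg (upTo m)) y∈
... | inj₁ y∈neg with ∈-map⁻ neg y∈neg
...   | k , k∈ , refl = ∈-upTo⁻ k∈
candidates-bounded m y∈ | inj₂ y∈pos with ∈-map⁻ pos y∈pos
...   | k , k∈ , refl = ∈-upTo⁻ k∈

candidates-unique : ∀ m → Unique (candidates m)
candidates-unique m =
  Unique.++⁺ (Unique.map⁺ (λ { refl → refl }) (Unique.upTo⁺ m)) (Unique.map⁺ (λ { refl → refl }) (Unique.upTo⁺ m)) disjoint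
  where
  disjoint : ∀ {v} → ¬ (v ∈ map neg (upTo m) × v ∈ map pos (upTo m))
  disjoint (v∈neg , v∈pos) with ∈-map⁻ neg v∈neg | ∈-map⁻ pos v∈pos
  ... | _ , _ , refl | _ , _ , ()

concatMap-prepend : {A : Set} {n : ℕ} (xs : List A) (vs : List (Vec A n)) →
  concatMap (λ x → map (x ∷_) vs) xs ≡ cartesianProductWith _∷_ xs vs
concatMap-prepend []       vs = refl
concatMap-prepend (x ∷ xs) vs = cong (map (x ∷_) vs ++_) (concatMap-prepend xs vs)

allVecs-unique : {A : Set} (n : ℕ) {L : List A} → Unique L → Unique (allVecs n L)
allVecs-unique zero    uL = All.[] ∷ []
allVecs-unique (suc n) {L} uL rewrite concatMap-prepend L (allVecs n L) =
  Unique.cartesianProductWith⁺ _∷_ ∷-injective uL (allVecs-unique n uL)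

∈-allVecs⁺ : {A : Set} (n : ℕ) {L : List A} (v : Vec A n) → (∀ i → lookup v i ∈ L) → v ∈ allVecs n L
∈-allVecs⁺ zero    []      _   = here refl
∈-allVecs⁺ (suc n) {L} (x ∷ v) ∈L rewrite concatMap-prepend L (allVecs n L) =
  ∈-cartesianProductWith⁺ _∷_ (∈L zero) (∈-allVecs⁺ n v (λ i → ∈L (suc i)))

∈-allVecs⁻ : {A : Set} (n : ℕ) {L : List A} (v : Vec A n) → v ∈ allVecs n L → ∀ i → lookup v i ∈ L
∈-allVecs⁻ (suc n) {L} v v∈ i rewrite concatMap-prepend L (allVecs n L)
  with ∈-cartesianProductWith⁻ _∷_ L (allVecs n L) v∈
∈-allVecs⁻ (suc n) _ _ zero    | _ , _ , x∈L , _  , refl = x∈L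
∈-allVecs⁻ (suc n) _ _ (suc i) | _ , u , _   , u∈ , refl = ∈-allVecs⁻ n u u∈ i

count-↭ : {A : Set} (p : A → Bool) {xs ys : List A} → xs ↭ ys → count p xs ≡ count p ys
count-↭ p ↭.refl             = refl
count-↭ p (↭.prep x xs↭ys)   = cong ((if p x then 1 else 0) +_) (count-↭ p xs↭ys)
count-↭ p (↭.swap x y xs↭ys) =
  trans (cong (λ c → (if p x then 1 else 0) + ((if p y then 1 else 0) + c)) (count-↭ p xs↭ys))
        (solve 3 (λ a b c → a :+ (b :+ c) := b :+ (a :+ c)) refl (if p x then 1 else 0) (if p y then 1 else 0) _)
count-↭ p (↭.trans xs↭ys ys↭zs) = trans (count-↭ p xs↭ys) (count-↭ p ys↭zs)

count-bijection : {A : Set} (xs : List A) → Unique xs → (φ ψ : A → A) →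
  (∀ x → ψ (φ x) ≡ x) → (∀ x → φ (ψ x) ≡ x) →
  (∀ {x} → x ∈ xs → φ x ∈ xs) → (∀ {x} → x ∈ xs → ψ x ∈ xs) →
  (p : A → Bool) → count (λ x → p (φ x)) xs ≡ count p xs
count-bijection xs uxs φ ψ ψφ φψ φ∈ ψ∈ p =
  trans (sym (count-map p φ xs)) (count-↭ p (∼bag⇒↭ (unique∧set⇒bag φxs-unique uxs (mk⇔ to from))))
  where
  φxs-unique : Unique (map φ xs)
  φxs-unique = Unique.map⁺ (λ {x} {y} e → trans (sym (ψφ x)) (trans (cong ψ e) (ψφ y))) uxs
  to : ∀ {z} → z ∈ map φ xs → z ∈ xs
  to z∈ with ∈-map⁻ φ z∈
  ... | x , x∈ , refl = φ∈ x∈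
  from : ∀ {z} → z ∈ xs → z ∈ map φ xs
  from {z} z∈ = subst (_∈ map φ xs) (φψ z) (∈-map⁺ φ (ψ∈ z∈))

count-cong : {A : Set} (p q : A → Bool) (xs : List A) → (∀ {x} → x ∈ xs → p x ≡ q x) → count p xs ≡ count q xs
count-cong p q []       p≡q = refl
count-cong p q (x ∷ xs) p≡q rewrite p≡q (here refl) = cong (_ +_) (count-cong p q xs (λ x∈ → p≡q (there x∈)))

count-tabulate : ∀ {A : Set} N (f : Fin N → A) (p : A → Bool) (q : ℕ → Bool) → (∀ i → p (f i) ≡ q (toℕ i)) →
  count p (List.tabulate f) ≡ sum< N (λ t → if q t then 1 else 0)
count-tabulate zero    f p q p≡q = refl
count-tabulate (suc N) f p q p≡q
  rewrite p≡q zero | count-tabulate N (λ i → f (suc i)) p (λ t → q (suc t)) (λ i → p≡q (suc i)) =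
  sym (sum<-suc-head N (λ t → if q t then 1 else 0))

module Chains (letter : ℕ → ℕ) (m : ℕ) where

  ascent : ℕ → Bool
  ascent i = does (letter i <? letter (suc i))

  open Transfer ascent public

  -- chain ℓ g: g lists the labels of letters ℓ − 1, …, 0, latest first.
  chain : (ℓ : ℕ) → Vec P′ ℓ → Bool
  chain zero          []          = true
  chain (suc zero)    (x ∷ [])    = true
  chain (suc (suc ℓ)) (x ∷ y ∷ g) = admissibleᵇ y (letter ℓ) x (letter (suc ℓ)) ∧ chain (suc ℓ) (y ∷ g)

  countFrom : P′ → ℕ → ℕ
  countFrom x ℓ = count (λ g → chain (suc ℓ) (x ∷ g)) (allVecs ℓ (candidates m))

  countFrom-suc : ∀ x ℓ → countFrom x (suc ℓ) ≡
    sum< m (λ k → if admissibleᵇ (neg k) (letter ℓ) x (letter (suc ℓ)) then countFrom (neg k) ℓ else 0) +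
    sum< m (λ k → if admissibleᵇ (pos k) (letter ℓ) x (letter (suc ℓ)) then countFrom (pos k) ℓ else 0)
  countFrom-suc x ℓ = trans (count-concatMap _ (λ y → map (y ∷_) (allVecs ℓ L)) L)
    (trans (cong sum (map-cong (λ y → trans (count-map _ (y ∷_) (allVecs ℓ L))
                                           (count-∧ (admissibleᵇ y (letter ℓ) x (letter (suc ℓ))) _ (allVecs ℓ L))) L))
           (sum-map-candidates m _))
    where L = candidates m

  CountsAreEnds : ℕ → Set
  CountsAreEnds ℓ = ∀ k → k < m → countFrom (pos k) ℓ ≡ endPos ℓ k × countFrom (neg k) ℓ ≡ endNeg ℓ k

  countFrom-step : ∀ ℓ → CountsAreEnds ℓ → ∀ y k → ∣ y ∣′ ≡ suc k → k < m → countFrom y (suc ℓ) ≡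
    (sum< k (endNeg ℓ) + (if admissibleᵇ (neg k) (letter ℓ) y (letter (suc ℓ)) then endNeg ℓ k else 0)) +
    (sum< k (endPos ℓ) + (if admissibleᵇ (pos k) (letter ℓ) y (letter (suc ℓ)) then endPos ℓ k else 0))
  countFrom-step ℓ ends y k ∣y∣ k<m = trans (countFrom-suc y ℓ) (cong₂ _+_
    (trans (sum<-cong m (λ i i<m → cong (if admissibleᵇ (neg i) a y b then_else 0) (proj₂ (ends i i<m))))
           (sum<-admissible neg (λ _ → refl) y k ∣y∣ m k<m a b (endNeg ℓ)))
    (trans (sum<-cong m (λ i i<m → cong (if admissibleᵇ (pos i) a y b then_else 0) (proj₁ (ends i i<m))))
           (sum<-admissible pos (λ _ → refl) y k ∣y∣ m k<m a b (endPos ℓ))))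
    where
    a = letter ℓ
    b = letter (suc ℓ)

  countFrom≡ends : ∀ ℓ → (∀ i → i < ℓ → letter i ≢ letter (suc i)) → CountsAreEnds ℓ
  countFrom≡ends zero    _        k _   = refl , refl
  countFrom≡ends (suc ℓ) distinct k k<m = countFrom-pos , countFrom-neg
    where
    ends = countFrom≡ends ℓ (λ i i<ℓ → distinct i (m<n⇒m<1+n i<ℓ))
    a = letter ℓ
    b = letter (suc ℓ)
    countFrom-pos : countFrom (pos k) (suc ℓ) ≡ endPos (suc ℓ) k
    countFrom-pos rewrite countFrom-step ℓ ends (pos k) k refl k<m
      | admissibleᵇ-rank< (neg k) a (pos k) b (n<1+n (2 * k)) | admissibleᵇ-pos k a b | prefix-split ℓ k =
      solve 4 (λ N n P p → (N :+ n) :+ (P :+ p) := ((P :+ N) :+ n) :+ p) refl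
        (sum< k (endNeg ℓ)) (endNeg ℓ k) (sum< k (endPos ℓ)) (if ascent ℓ then endPos ℓ k else 0)
    countFrom-neg : countFrom (neg k) (suc ℓ) ≡ endNeg (suc ℓ) k
    countFrom-neg rewrite countFrom-step ℓ ends (neg k) k refl k<m
      | admissibleᵇ-neg k a b | does-flip-< a b (distinct ℓ (n<1+n ℓ))
      | admissibleᵇ-rank> (pos k) a (neg k) b (n<1+n (2 * k)) | prefix-split ℓ k with ascent ℓ
    ... | true  = solve 2 (λ N P → (N :+ con 0) :+ (P :+ con 0) := (P :+ N) :+ con 0) refl
                    (sum< k (endNeg ℓ)) (sum< k (endPos ℓ))
    ... | false = solve 3 (λ N n P → (N :+ n) :+ (P :+ con 0) := (P :+ N) :+ n) refl
                    (sum< k (endNeg ℓ)) (endNeg ℓ k) (sum< k (endPos ℓ))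

  Pairwise : (ℓ : ℕ) → Vec P′ ℓ → Set
  Pairwise ℓ g = ∀ (p q : Fin ℓ) → p <ᶠ q →
    Admissible (lookup g q) (letter (ℓ ∸ suc (toℕ q))) (lookup g p) (letter (ℓ ∸ suc (toℕ p)))

  chain⇒pairwise : ∀ ℓ (g : Vec P′ ℓ) → chain ℓ g ≡ true → Pairwise ℓ g
  chain⇒pairwise (suc (suc ℓ)) (x ∷ y ∷ g) c zero (suc zero) _ = does-true (admissible? _ _ _ _) (proj₁ (∧-true c))
  chain⇒pairwise (suc (suc ℓ)) (x ∷ y ∷ g) c zero (suc (suc q)) _ =
    admissible-trans (chain⇒pairwise (suc ℓ) (y ∷ g) (proj₂ (∧-true c)) zero (suc q) (s≤s z≤n))
                     (does-true (admissible? _ _ _ _) (proj₁ (∧-true c)))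
  chain⇒pairwise (suc (suc ℓ)) (x ∷ y ∷ g) c (suc p) (suc q) (s≤s p<q) =
    chain⇒pairwise (suc ℓ) (y ∷ g) (proj₂ (∧-true c)) p q p<q

  pairwise⇒chain : ∀ ℓ (g : Vec P′ ℓ) → Pairwise ℓ g → chain ℓ g ≡ true
  pairwise⇒chain zero          []          _  = refl
  pairwise⇒chain (suc zero)    (x ∷ [])    _  = refl
  pairwise⇒chain (suc (suc ℓ)) (x ∷ y ∷ g) pw =
    cong₂ _∧_ (dec-true (admissible? y (letter ℓ) x (letter (suc ℓ))) (pw zero (suc zero) (s≤s z≤n)))
              (pairwise⇒chain (suc ℓ) (y ∷ g) (λ p q p<q → pw (suc p) (suc q) (s≤s p<q)))

  count-chains : ∀ ℓ → count (chain (suc ℓ)) (allVecs (suc ℓ) (candidates m)) ≡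
    sum< m (λ k → countFrom (neg k) ℓ) + sum< m (λ k → countFrom (pos k) ℓ)
  count-chains ℓ = trans (count-concatMap _ (λ x → map (x ∷_) (allVecs ℓ L)) L)
    (trans (cong sum (map-cong (λ x → count-map _ (x ∷_) (allVecs ℓ L)) L)) (sum-map-candidates m (λ x → countFrom x ℓ)))
    where L = candidates m

  count-chains-closed-form : ∀ ℓ → (∀ i → i < ℓ → letter i ≢ letter (suc i)) →
    count (chain (suc ℓ)) (allVecs (suc ℓ) (candidates m)) ≡
    2 ^ (2 * peaksBelow ℓ + 1) * coeff (suc (peaksBelow ℓ)) (suc ℓ ∸ 2 * peaksBelow ℓ ∸ 1) (suc (suc ℓ)) m
  count-chains-closed-form ℓ distinct = begin
    count (chain (suc ℓ)) (allVecs (suc ℓ) (candidates m))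
      ≡⟨ count-chains ℓ ⟩
    sum< m (λ k → countFrom (neg k) ℓ) + sum< m (λ k → countFrom (pos k) ℓ)
      ≡⟨ cong₂ _+_ (sum<-cong m (λ k k<m → proj₂ (ends k k<m))) (sum<-cong m (λ k k<m → proj₁ (ends k k<m))) ⟩
    sum< m (endNeg ℓ) + sum< m (endPos ℓ)
      ≡⟨ trans (+-comm (sum< m (endNeg ℓ)) _) (sym (prefix-split ℓ m)) ⟩
    prefix ℓ m
      ≡⟨ prefix-closed-form ℓ m ⟩
    2 ^ (2 * peaksBelow ℓ + 1) * coeff (suc (peaksBelow ℓ)) (suc ℓ ∸ 2 * peaksBelow ℓ ∸ 1) (suc (suc ℓ)) m ∎
    where
    open ≡-Reasoning
    ends = countFrom≡ends ℓ distinct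

-- Enriched w-partitions as chains

module Word {n : ℕ} (w : Permutation′ n) (m : ℕ) where

  -- Past the end the word is padded with the value n, so its last letter is never a peak.
  letter : ℕ → ℕ
  letter i with i <? n
  ... | yes i<n = toℕ (w ⟨$⟩ʳ fromℕ< i<n)
  ... | no  _   = n

  open Chains letter m public

  letter-toℕ : ∀ i → letter (toℕ i) ≡ toℕ (w ⟨$⟩ʳ i)
  letter-toℕ i with toℕ i <? n
  ... | yes i<n = cong (λ j → toℕ (w ⟨$⟩ʳ j)) (fromℕ<-toℕ i i<n)
  ... | no  i≮n = ⊥-elim (i≮n (toℕ<n i))

  letter-fromℕ< : ∀ {i} (i<n : i < n) → letter i ≡ toℕ (w ⟨$⟩ʳ fromℕ< i<n)
  letter-fromℕ< {i} i<n = trans (cong letter (sym (toℕ-fromℕ< i<n))) (letter-toℕ (fromℕ< i<n))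

  letter-beyond : ∀ {i} → ¬ i < n → letter i ≡ n
  letter-beyond {i} i≮n with i <? n
  ... | yes i<n = ⊥-elim (i≮n i<n)
  ... | no  _   = refl

  letter<n : ∀ {i} → i < n → letter i < n
  letter<n i<n = subst (_< n) (sym (letter-fromℕ< i<n)) (toℕ<n _)

  letters-distinct : ∀ i → suc i < n → letter i ≢ letter (suc i)
  letters-distinct i si<n eq =
    1+n≢n (sym (trans (sym (toℕ-fromℕ< i<n)) (trans (cong toℕ positions≡) (toℕ-fromℕ< si<n))))
    where
    i<n = <-trans (n<1+n i) si<n
    positions≡ : fromℕ< i<n ≡ fromℕ< si<n
    positions≡ = trans (sym (inverseˡ w)) (trans (cong (w ⟨$⟩ˡ_)
      (toℕ-injective (trans (sym (letter-fromℕ< i<n)) (trans eq (letter-fromℕ< si<n))))) (inverseˡ w))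

  -- relabel g turns the labels g of the letters, listed from the last letter to the first,
  -- into the labeling f of the values, f (w i) = g (n − 1 − i).
  relabel : Vec P′ n → Vec P′ n
  relabel g = tabulate (λ v → lookup g (opposite (w ⟨$⟩ˡ v)))

  unrelabel : Vec P′ n → Vec P′ n
  unrelabel f = tabulate (λ p → lookup f (w ⟨$⟩ʳ opposite p))

  relabel-letter : ∀ g i → lookup (relabel g) (w ⟨$⟩ʳ i) ≡ lookup g (opposite i)
  relabel-letter g i = trans (lookup∘tabulate _ (w ⟨$⟩ʳ i)) (cong (λ j → lookup g (opposite j)) (inverseˡ w))

  unrelabel∘relabel : ∀ g → unrelabel (relabel g) ≡ g
  unrelabel∘relabel g =
    trans (tabulate-cong (λ p → trans (relabel-letter g (opposite p)) (cong (lookup g) (opposite-involutive p))))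
          (tabulate∘lookup g)

  relabel∘unrelabel : ∀ f → relabel (unrelabel f) ≡ f
  relabel∘unrelabel f = trans (tabulate-cong (λ v → trans (lookup∘tabulate _ (opposite (w ⟨$⟩ˡ v)))
    (trans (cong (λ j → lookup f (w ⟨$⟩ʳ j)) (opposite-involutive _)) (cong (lookup f) (inverseʳ w))))) (tabulate∘lookup f)

  ∈-allVecs-tabulate : ∀ (f : Fin n → Fin n) (g : Vec P′ n) → g ∈ allVecs n (candidates m) →
    tabulate (λ v → lookup g (f v)) ∈ allVecs n (candidates m)
  ∈-allVecs-tabulate f g g∈ =
    ∈-allVecs⁺ n _ (λ v → subst (_∈ candidates m) (sym (lookup∘tabulate _ v)) (∈-allVecs⁻ n g g∈ (f v)))

  letter-opposite : ∀ i → letter (n ∸ suc (toℕ (opposite i))) ≡ toℕ (w ⟨$⟩ʳ i)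
  letter-opposite i = trans (cong letter (sym (opposite-prop (opposite i))))
    (trans (cong (λ j → letter (toℕ j)) (opposite-involutive i)) (letter-toℕ i))

  opposite-< : ∀ (i j : Fin n) → i <ᶠ j → opposite j <ᶠ opposite i
  opposite-< i j i<j rewrite opposite-prop i | opposite-prop j = ∸-monoʳ-< (s≤s i<j) (toℕ<n j)

  pairwise⇒enriched : ∀ g → Pairwise n g → IsEnriched w (relabel g)
  pairwise⇒enriched g pw = record
    { weak    = λ i j i<j → proj₁ (admissible i j i<j)
    ; posCond = λ i j i<j → proj₁ (proj₂ (admissible i j i<j))
    ; negCond = λ i j i<j → proj₂ (proj₂ (admissible i j i<j)) }
    where
    admissible : ∀ i j → i <ᶠ j → Admissible (lookup (relabel g) (w ⟨$⟩ʳ i)) (toℕ (w ⟨$⟩ʳ i))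
                                             (lookup (relabel g) (w ⟨$⟩ʳ j)) (toℕ (w ⟨$⟩ʳ j))
    admissible i j i<j = Admissible-cong (sym (relabel-letter g i)) (letter-opposite i) (sym (relabel-letter g j)) (letter-opposite j)
      (pw (opposite j) (opposite i) (opposite-< i j i<j))

  enriched⇒pairwise : ∀ g → IsEnriched w (relabel g) → Pairwise n g
  enriched⇒pairwise g enriched p q p<q = Admissible-cong (at q) (letter-at q) (at p) (letter-at p)
    (IsEnriched.weak enriched i j i<j , IsEnriched.posCond enriched i j i<j , IsEnriched.negCond enriched i j i<j)
    where
    i = opposite q
    j = opposite p
    i<j = opposite-< p q p<q
    at : ∀ r → lookup (relabel g) (w ⟨$⟩ʳ opposite r) ≡ lookup g r
    at r = trans (relabel-letter g (opposite r)) (cong (lookup g) (opposite-involutive r))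
    letter-at : ∀ r → toℕ (w ⟨$⟩ʳ opposite r) ≡ letter (n ∸ suc (toℕ r))
    letter-at r = trans (sym (letter-toℕ (opposite r))) (cong letter (opposite-prop r))

  enriched≡chain : ∀ g → does (isEnriched? w (relabel g)) ≡ chain n g
  enriched≡chain g = does≡ (isEnriched? w (relabel g)) (chain n g)
    (λ enriched → pairwise⇒chain n g (enriched⇒pairwise g enriched))
    (λ c → pairwise⇒enriched g (chain⇒pairwise n g c))

  Ω≡count-chains : Ω w m ≡ count (chain n) (allVecs n (candidates m))
  Ω≡count-chains = begin
    Ω w m
      ≡⟨ length-filter≡count (λ f → isEnriched? w f ×-dec bounded? m f) all ⟩
    count (λ f → does (isEnriched? w f ×-dec bounded? m f)) all
      ≡⟨ count-bijection all (allVecs-unique n (candidates-unique m)) relabel unrelabel unrelabel∘relabel relabel∘unrelabel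
           (∈-allVecs-tabulate _ _) (∈-allVecs-tabulate _ _) _ ⟨
    count (λ g → does (isEnriched? w (relabel g) ×-dec bounded? m (relabel g))) all
      ≡⟨ count-cong _ (chain n) all labels-bounded ⟩
    count (chain n) all ∎
    where
    open ≡-Reasoning
    all = allVecs n (candidates m)
    labels-bounded : ∀ {g} → g ∈ all → does (isEnriched? w (relabel g) ×-dec bounded? m (relabel g)) ≡ chain n g
    labels-bounded {g} g∈
      rewrite dec-true (bounded? m (relabel g))
                       (λ v → candidates-bounded m (∈-allVecs⁻ n (relabel g) (∈-allVecs-tabulate _ g g∈) v))
            | ∧-identityʳ (does (isEnriched? w (relabel g))) = enriched≡chain g

  peak-letters : ∀ (i : Fin n) → does (isPeak? w i) ≡ isPeakᵇ (toℕ i)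
  peak-letters i = does≡ (isPeak? w i) (isPeakᵇ (toℕ i)) peak⇒ (⇒peak (toℕ i) refl)
    where
    peak⇒ : IsPeak w i → isPeakᵇ (toℕ i) ≡ true
    peak⇒ (j , k , sj≡i , k≡si , wj<wi , wk<wi) = subst (λ t → isPeakᵇ t ≡ true) sj≡i
      (cong₂ (λ up down → up ∧ not down)
        (dec-true (letter (toℕ j) <? letter (suc (toℕ j)))
                  (subst₂ _<_ (sym (letter-toℕ j)) (sym letter-i) wj<wi))
        (dec-false (letter (suc (toℕ j)) <? letter (suc (suc (toℕ j))))
                   (<-asym (subst₂ _<_ (sym letter-k) (sym letter-i) wk<wi))))
      where
      letter-i : letter (suc (toℕ j)) ≡ toℕ (w ⟨$⟩ʳ i)
      letter-i = trans (cong letter sj≡i) (letter-toℕ i)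
      letter-k : letter (suc (suc (toℕ j))) ≡ toℕ (w ⟨$⟩ʳ k)
      letter-k = trans (cong letter (trans (cong suc sj≡i) (sym k≡si))) (letter-toℕ k)
    ⇒peak : ∀ t → t ≡ toℕ i → isPeakᵇ t ≡ true → IsPeak w i
    ⇒peak (suc t) t≡i peak with ∧-true peak
    ... | up , not-up = fromℕ< t<n , fromℕ< ss<n
        , trans (cong suc (toℕ-fromℕ< t<n)) t≡i , trans (toℕ-fromℕ< ss<n) (cong suc t≡i)
        , subst₂ _<_ (letter-fromℕ< t<n) letter-i (does-true (letter t <? letter (suc t)) up)
        , subst₂ _<_ (letter-fromℕ< ss<n) letter-i (≤∧≢⇒< (≮⇒≥ no-ascent) (letters-distinct (suc t) ss<n ∘ sym))
      where
      no-ascent : ¬ letter (suc t) < letter (suc (suc t))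
      no-ascent = does-false (letter (suc t) <? letter (suc (suc t))) (not-true not-up)
      st<n : suc t < n
      st<n = subst (_< n) (sym t≡i) (toℕ<n i)
      ss<n : suc (suc t) < n
      ss<n = decidable-stable (suc (suc t) <? n)
        (λ ss≮n → no-ascent (subst (letter (suc t) <_) (sym (letter-beyond ss≮n)) (letter<n st<n)))
      t<n : t < n
      t<n = <-trans (n<1+n t) st<n
      letter-i : letter (suc t) ≡ toℕ (w ⟨$⟩ʳ i)
      letter-i = trans (cong letter t≡i) (letter-toℕ i)

  pk≡peaksBelow : ∀ ℓ → suc ℓ ≡ n → pk w ≡ peaksBelow ℓ
  pk≡peaksBelow ℓ n≡ = begin
    pk w
      ≡⟨ length-filter≡count (isPeak? w) (allFin n) ⟩
    count (λ i → does (isPeak? w i)) (allFin n)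
      ≡⟨ count-tabulate n (λ i → i) _ isPeakᵇ peak-letters ⟩
    sum< n peakIndicator
      ≡⟨ cong (λ N → sum< N peakIndicator) (sym n≡) ⟩
    peaksBelow ℓ + (if isPeakᵇ ℓ then 1 else 0)
      ≡⟨ cong (λ b → peaksBelow ℓ + (if b then 1 else 0))
              (trans (cong (λ up → ascentInto ℓ ∧ not up) last-ascent) (∧-zeroʳ _)) ⟩
    peaksBelow ℓ + 0
      ≡⟨ +-identityʳ _ ⟩
    peaksBelow ℓ ∎
    where
    open ≡-Reasoning
    peakIndicator = λ t → if isPeakᵇ t then 1 else 0
    last-ascent : ascent ℓ ≡ true
    last-ascent = dec-true (letter ℓ <? letter (suc ℓ))
      (subst (letter ℓ <_) (sym (letter-beyond (λ sℓ<n → <-irrefl n≡ sℓ<n))) (letter<n (subst (ℓ <_) n≡ (n<1+n ℓ))))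

mainTheorem9 : (n : ℕ) → 1 ≤ n → (w : Permutation′ n) → (m : ℕ) → 1 ≤ m →
    Ω w m ≡ 2 ^ (2 * pk w + 1) *
      sumBelow (m ∸ pk w)
        (λ k → multichoose (n + 1) k * ((n ∸ 2 * pk w ∸ 1) C (m ∸ 1 ∸ pk w ∸ k)))
-- The formula holds for m = 0 as well.
mainTheorem9 (suc ℓ) _ w m _ = begin
  Ω w m
    ≡⟨ Ω≡count-chains ⟩
  count (chain (suc ℓ)) (allVecs (suc ℓ) (candidates m))
    ≡⟨ count-chains-closed-form ℓ (λ i i<ℓ → letters-distinct i (s≤s i<ℓ)) ⟩
  2 ^ (2 * P + 1) * coeff (suc P) (suc ℓ ∸ 2 * P ∸ 1) (suc (suc ℓ)) m
    ≡⟨ cong (2 ^ (2 * P + 1) *_) (coeff≡sumBelow P (suc ℓ ∸ 2 * P ∸ 1) (suc (suc ℓ)) m) ⟩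
  formula (suc (suc ℓ)) P
    ≡⟨ cong₂ formula (+-comm 1 (suc ℓ)) (sym (pk≡peaksBelow ℓ refl)) ⟩
  formula (suc ℓ + 1) (pk w) ∎
  where
  open ≡-Reasoning
  open Word w m
  P = peaksBelow ℓ
  formula : ℕ → ℕ → ℕ
  formula c p = 2 ^ (2 * p + 1) * sumBelow (m ∸ p) (λ k → multichoose c k * ((suc ℓ ∸ 2 * p ∸ 1) C (m ∸ 1 ∸ p ∸ k)))
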